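{- For every monotone graph $G$ with at least one edge, $\mathrm{pw}(G)\leq 2\,\psi(G)-1$.
   Context: A bipartite graph $G$ with parts $L,R$ is monotone if $L$ and $R$ can be linearly ordered so that the bipartite adjacency matrix $A$ (rows indexed by $L$, columns by $R$, in these orders) contains none of the $2\times2$ submatrices $\begin{pmatrix}1&1\\1&0\end{pmatrix}$, $\begin{pmatrix}0&1\\1&0\end{pmatrix}$, $\begin{pmatrix}0&1\\1&1\end{pmatrix}$ (on rows $i<i'$ and columns $j<j'$). $\psi(G)=\max\{d: K_{d,d}\subseteq G\}$. A path decomposition of $G=(V,E)$ is a sequence $(B_1,\dots,B_r)$ of subsets of $V$ such that every vertex lies in some $B_i$, every edge is contained in some $B_i$, and for each vertex $v$ the set $\{i: v\in B_i\}$ is an interval; its width is $\max_i|B_i|-1$, and $\mathrm{pw}(G)$ is the minimum width. -}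

module Defs where

open import Data.Nat using (ℕ; _+_; _*_; _≤_; _<_)
open import Data.Bool using (Bool; true; false)
open import Data.Fin using (Fin) renaming (_<_ to _<ᶠ_; _≤_ to _≤ᶠ_)
open import Data.Fin.Subset using (Subset) renaming (_∈_ to _∈ₛ_; ∣_∣ to card)
open import Data.Fin.Permutation using (Permutation′; _⟨$⟩ʳ_)
open import Data.Sum using (_⊎_; inj₁; inj₂)
open import Data.Product using (Σ; ∃; _×_; _,_)
open import Data.Empty using (⊥)
open import Data.Unit using (⊤)
open import Relation.Binary.PropositionalEquality using (_≡_)
open import Relation.Nullary using (¬_)
open import Function.Definitions using (Injective)

-- A bipartite graph with parts L = Fin m and R = Fin n, given by its
-- bipartite adjacency matrix A (rows indexed by L, columns by R).
BipMatrix : ℕ → ℕ → Set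
BipMatrix m n = Fin m → Fin n → Bool

Vertex : ℕ → ℕ → Set
Vertex m n = Fin m ⊎ Fin n

Adj : ∀ {m n} → BipMatrix m n → Vertex m n → Vertex m n → Set
Adj A (inj₁ i) (inj₂ j) = A i j ≡ true
Adj A (inj₂ j) (inj₁ i) = A i j ≡ true
Adj A (inj₁ _) (inj₁ _) = ⊥
Adj A (inj₂ _) (inj₂ _) = ⊥

HasEdge : ∀ {m n} → BipMatrix m n → Set
HasEdge A = Σ _ λ u → Σ _ λ v → Adj A u v

Forbidden : Bool → Bool → Bool → Bool → Set
Forbidden true  true true true  = ⊥
Forbidden true  true true false = ⊤
Forbidden false true true false = ⊤
Forbidden false true true true  = ⊤
Forbidden _     _    _    _     = ⊥

Monotone : ∀ {m n} → BipMatrix m n → Set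
Monotone {m} {n} A =
  Σ (Permutation′ m) λ σ → Σ (Permutation′ n) λ τ →
    ∀ (i i' : Fin m) (j j' : Fin n) → i <ᶠ i' → j <ᶠ j' →
      ¬ Forbidden (A (σ ⟨$⟩ʳ i)  (τ ⟨$⟩ʳ j)) (A (σ ⟨$⟩ʳ i)  (τ ⟨$⟩ʳ j'))
                  (A (σ ⟨$⟩ʳ i') (τ ⟨$⟩ʳ j)) (A (σ ⟨$⟩ʳ i') (τ ⟨$⟩ʳ j'))

ContainsKdd : ∀ {m n} → BipMatrix m n → ℕ → Set
ContainsKdd {m} {n} A d =
  Σ (Fin d → Vertex m n) λ f → Σ (Fin d → Vertex m n) λ g →
    Injective _≡_ _≡_ f × Injective _≡_ _≡_ g ×
    (∀ a b → ¬ (f a ≡ g b)) ×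
    (∀ a b → Adj A (f a) (g b))

IsPsi : ∀ {m n} → BipMatrix m n → ℕ → Set
IsPsi A k = ContainsKdd A k × (∀ d → ContainsKdd A d → d ≤ k)

Bag : ℕ → ℕ → Set
Bag m n = Subset m × Subset n

_∈B_ : ∀ {m n} → Vertex m n → Bag m n → Set
inj₁ i ∈B (S , _) = i ∈ₛ S
inj₂ j ∈B (_ , T) = j ∈ₛ T

size : ∀ {m n} → Bag m n → ℕ
size (S , T) = card S + card T

record PathDecomposition {m n} (A : BipMatrix m n) : Set where
  field
    r     : ℕ
    bag   : Fin r → Bag m n
    cover : ∀ (v : Vertex m n) → Σ (Fin r) λ i → v ∈B bag i
    edges : ∀ (u v : Vertex m n) → Adj A u v →
              Σ (Fin r) λ i → (u ∈B bag i) × (v ∈B bag i)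
    interval : ∀ (v : Vertex m n) (i j k : Fin r) → i ≤ᶠ j → j ≤ᶠ k →
              v ∈B bag i → v ∈B bag k → v ∈B bag j

-- width ≤ w  ⟺  every bag has at most w + 1 vertices.
-- pw(G) ≤ 2ψ − 1 (with ψ ≥ 1) is: some decomposition has all bags of size ≤ 2ψ.
HasPathDecompWithBagsAtMost : ∀ {m n} → BipMatrix m n → ℕ → Set
HasPathDecompWithBagsAtMost A s =
  Σ (PathDecomposition A) λ P →
    ∀ i → size (PathDecomposition.bag P i) ≤ s

module Submission where

-- Order rows and columns as in the definition of monotonicity: then whenever
-- the anti-diagonal of a 2×2 submatrix is full, so is its diagonal.  Sweep a
-- staircase through the matrix, introducing at each step either the next row
-- or the next column.  The bag of a step holds the vertex just introduced and
-- the introduced rows (columns) that still have a neighbour among the columns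
-- (rows) not yet introduced; every edge is then covered when its later
-- endpoint is introduced, and every vertex stays for an interval of steps.
-- After p rows and q columns, the active rows and active columns are
-- completely joined, and the first non-isolated row from p together with the
-- first non-isolated column from q extends them by one row and one column.
-- So ψ active rows and ψ active columns would give K_{ψ+1,ψ+1}; hence one side
-- always has fewer than ψ active vertices and the sweep can advance there,
-- keeping at most ψ rows and ψ columns in every bag.

open import Defs

import Algebra.Properties.CommutativeMonoid.Sum as MonoidSum
open import Data.Bool using (Bool; true; false; if_then_else_)
import Data.Bool as Bool
open import Data.Empty using (⊥; ⊥-elim)
open import Data.Fin using (Fin; zero; suc; toℕ; fromℕ<) renaming (_<_ to _<ᶠ_)
open import Data.Fin.Permutation using (Permutation′; _⟨$⟩ʳ_; _⟨$⟩ˡ_; flip; inverseʳ)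
import Data.Fin.Properties as Finₚ
open Finₚ using (toℕ-injective)
open import Data.Fin.Subset using (Subset; inside; outside; _∈_; _∪_; ∣_∣)
open import Data.Fin.Subset.Properties
  using (∣p∣≤∣x∷p∣; Empty-unique; ∣⊥∣≡0; p⊆q⇒∣p∣≤∣q∣; x∈p∪q⁺)
open import Data.Nat
  using (ℕ; zero; suc; _+_; _*_; _≤_; _<_; _≤′_; ≤′-refl; ≤′-step; z≤n; s≤s; _<?_; _≤?_)
open import Data.Nat.Properties
open import Data.Product using (Σ; ∃; _×_; _,_; proj₁; proj₂)
import Data.Product as Product
open import Data.Sum using (_⊎_; inj₁; inj₂; [_,_]′)
import Data.Sum as Sum
open import Data.Sum.Properties using (inj₁-injective; inj₂-injective)
open import Data.Unit using (tt)
open import Data.Vec using ([]; _∷_; tabulate; here; there)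
import Data.Vec.Functional as Vector
open import Data.Vec.Properties using (lookup∘tabulate; []=⇒lookup; lookup⇒[]=)
open import Function using (_∘_; case_of_)
open import Function.Bundles using (Injection)
open import Function.Definitions using (Injective)
open import Function.Properties.Inverse using (↔⇒↣)
open import Level using (0ℓ)
open import Relation.Binary.Definitions using (tri<; tri≈; tri>)
open import Relation.Binary.PropositionalEquality
open import Relation.Nullary using (Dec; yes; no; does; ¬_)
open import Relation.Nullary.Decidable using (dec-true; _×-dec_; _⊎-dec_)
open import Relation.Unary using (Pred; Decidable; _⊆_)

private variable n : ℕ

-- Counting elements of subsets and decidable predicates

∣p∪q∣≤∣p∣+∣q∣ : (p q : Subset n) → ∣ p ∪ q ∣ ≤ ∣ p ∣ + ∣ q ∣
∣p∪q∣≤∣p∣+∣q∣ []            []           = z≤n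
∣p∪q∣≤∣p∣+∣q∣ (inside  ∷ p) (s ∷ q)      =
  s≤s (≤-trans (∣p∪q∣≤∣p∣+∣q∣ p q) (+-monoʳ-≤ ∣ p ∣ (∣p∣≤∣x∷p∣ s q)))
∣p∪q∣≤∣p∣+∣q∣ (outside ∷ p) (outside ∷ q) = ∣p∪q∣≤∣p∣+∣q∣ p q
∣p∪q∣≤∣p∣+∣q∣ (outside ∷ p) (inside  ∷ q) =
  subst (∣ p ∪ q ∣ <_) (sym (+-suc ∣ p ∣ ∣ q ∣)) (s≤s (∣p∪q∣≤∣p∣+∣q∣ p q))

subsingleton⇒∣p∣≤1 : (p : Subset n) → (∀ {x y} → x ∈ p → y ∈ p → x ≡ y) → ∣ p ∣ ≤ 1
subsingleton⇒∣p∣≤1 []            _      = z≤n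
subsingleton⇒∣p∣≤1 (outside ∷ p) unique =
  subsingleton⇒∣p∣≤1 p λ x∈p y∈p → Finₚ.suc-injective (unique (there x∈p) (there y∈p))
subsingleton⇒∣p∣≤1 {suc n} (inside ∷ p) unique = s≤s (≤-reflexive ∣p∣≡0)
  where
  ∣p∣≡0 : ∣ p ∣ ≡ 0
  ∣p∣≡0 = trans (cong ∣_∣ (Empty-unique λ (x , x∈p) → case unique here (there x∈p) of λ ())) (∣⊥∣≡0 n)

fresh∷-injective : ∀ {A : Set} {d} {x : A} {f : Fin d → A} →
                   Injective _≡_ _≡_ f → (∀ a → f a ≢ x) → Injective _≡_ _≡_ (x Vector.∷ f)
fresh∷-injective f-inj fresh {zero}  {zero}  _  = refl
fresh∷-injective f-inj fresh {zero}  {suc b} eq = ⊥-elim (fresh b (sym eq))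
fresh∷-injective f-inj fresh {suc a} {zero}  eq = ⊥-elim (fresh a eq)
fresh∷-injective f-inj fresh {suc a} {suc b} eq = cong suc (f-inj eq)

Enumeration : ∀ {n} → Pred (Fin n) 0ℓ → ℕ → Set
Enumeration {n} P d = Σ (Fin d → Fin n) λ e → Injective _≡_ _≡_ e × (∀ a → P (e a))

enumerate : (p : Subset n) {d : ℕ} → d ≤ ∣ p ∣ → Enumeration (_∈ p) d
enumerate p {zero} _ = (λ ()) , (λ { {()} }) , λ ()
enumerate (outside ∷ p) {suc d} d<∣p∣ with enumerate p d<∣p∣
... | e , e-inj , e∈p = suc ∘ e , e-inj ∘ Finₚ.suc-injective , there ∘ e∈p
enumerate (inside ∷ p) {suc d} (s≤s d≤∣p∣) with enumerate p d≤∣p∣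
... | e , e-inj , e∈p =
  zero Vector.∷ suc ∘ e , fresh∷-injective (e-inj ∘ Finₚ.suc-injective) (λ _ ()) , λ where
    zero    → here
    (suc a) → there (e∈p a)

open MonoidSum +-0-commutativeMonoid using (sum; sum-permute)

∣tabulate∣≡sum : (f : Fin n → Bool) → ∣ tabulate f ∣ ≡ sum (λ i → if f i then 1 else 0)
∣tabulate∣≡sum {zero}  f = refl
∣tabulate∣≡sum {suc n} f with f zero
... | true  = cong suc (∣tabulate∣≡sum (f ∘ suc))
... | false = ∣tabulate∣≡sum (f ∘ suc)

∣tabulate∣-permute : (f : Fin n → Bool) (π : Permutation′ n) →
                     ∣ tabulate (f ∘ (π ⟨$⟩ˡ_)) ∣ ≡ ∣ tabulate f ∣
∣tabulate∣-permute f π = begin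
  ∣ tabulate (f ∘ (π ⟨$⟩ˡ_)) ∣               ≡⟨ ∣tabulate∣≡sum (f ∘ (π ⟨$⟩ˡ_)) ⟩
  sum ((λ i → if f i then 1 else 0) ∘ (π ⟨$⟩ˡ_)) ≡⟨ sum-permute _ (flip π) ⟨
  sum (λ i → if f i then 1 else 0)           ≡⟨ ∣tabulate∣≡sum f ⟨
  ∣ tabulate f ∣                              ∎
  where open ≡-Reasoning

does≡true⇒ : ∀ {A : Set} (a? : Dec A) → does a? ≡ true → A
does≡true⇒ (yes a) _ = a

⟦_⟧ : {P : Pred (Fin n) 0ℓ} → Decidable P → Subset n
⟦ P? ⟧ = tabulate (does ∘ P?)

module _ {P : Pred (Fin n) 0ℓ} (P? : Decidable P) where

  ∈⟦⟧⁺ : ∀ {i} → P i → i ∈ ⟦ P? ⟧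
  ∈⟦⟧⁺ {i} Pi = lookup⇒[]= i _ (trans (lookup∘tabulate _ i) (dec-true (P? i) Pi))

  ∈⟦⟧⁻ : ∀ {i} → i ∈ ⟦ P? ⟧ → P i
  ∈⟦⟧⁻ {i} i∈ = does≡true⇒ (P? i) (trans (sym (lookup∘tabulate _ i)) ([]=⇒lookup i∈))

  ∣⟦⟧∣≡0 : (∀ {i} → ¬ P i) → ∣ ⟦ P? ⟧ ∣ ≡ 0
  ∣⟦⟧∣≡0 ¬P = trans (cong ∣_∣ (Empty-unique λ (_ , i∈) → ¬P (∈⟦⟧⁻ i∈))) (∣⊥∣≡0 n)

  enumerate⟦⟧ : ∀ {d} → d ≤ ∣ ⟦ P? ⟧ ∣ → Enumeration P d
  enumerate⟦⟧ d≤ with enumerate ⟦ P? ⟧ d≤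
  ... | e , e-inj , e∈ = e , e-inj , ∈⟦⟧⁻ ∘ e∈

module _ {P Q : Pred (Fin n) 0ℓ} (P? : Decidable P) (Q? : Decidable Q) where

  ∣⟦⟧∣-mono : P ⊆ Q → ∣ ⟦ P? ⟧ ∣ ≤ ∣ ⟦ Q? ⟧ ∣
  ∣⟦⟧∣-mono P⊆Q = p⊆q⇒∣p∣≤∣q∣ (∈⟦⟧⁺ Q? ∘ P⊆Q ∘ ∈⟦⟧⁻ P?)

  -- p may be ≥ n, so the extra element is given by toℕ i ≡ p, not as a Fin n.
  ∣⟦⟧∣≤1+ : ∀ p → (∀ {i} → P i → toℕ i ≡ p ⊎ Q i) → ∣ ⟦ P? ⟧ ∣ ≤ suc ∣ ⟦ Q? ⟧ ∣
  ∣⟦⟧∣≤1+ p P⊆p∪Q = begin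
    ∣ ⟦ P? ⟧ ∣           ≤⟨ p⊆q⇒∣p∣≤∣q∣ (x∈p∪q⁺ ∘ [ inj₁ ∘ ∈⟦⟧⁺ ≟p , inj₂ ∘ ∈⟦⟧⁺ Q? ]′ ∘ P⊆p∪Q ∘ ∈⟦⟧⁻ P?) ⟩
    ∣ ⟦ ≟p ⟧ ∪ ⟦ Q? ⟧ ∣  ≤⟨ ∣p∪q∣≤∣p∣+∣q∣ ⟦ ≟p ⟧ ⟦ Q? ⟧ ⟩
    ∣ ⟦ ≟p ⟧ ∣ + ∣ ⟦ Q? ⟧ ∣ ≤⟨ +-monoˡ-≤ _ (subsingleton⇒∣p∣≤1 ⟦ ≟p ⟧ λ i∈ j∈ →
                                toℕ-injective (trans (∈⟦⟧⁻ ≟p i∈) (sym (∈⟦⟧⁻ ≟p j∈)))) ⟩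
    suc ∣ ⟦ Q? ⟧ ∣        ∎
    where
    open ≤-Reasoning
    ≟p : Decidable (λ i → toℕ i ≡ p)
    ≟p i = toℕ i ≟ p

Least : Pred (Fin n) 0ℓ → Pred (Fin n) 0ℓ
Least P i = P i × (∀ j → P j → toℕ i ≤ toℕ j)

least : {P : Pred (Fin n) 0ℓ} → Decidable P → Σ (Fin n) P → Σ (Fin n) (Least P)
least {suc n} P? (i , Pi) with P? zero
... | yes P0 = zero , P0 , λ _ _ → z≤n
least {suc n} P? (zero  , P0) | no ¬P0 = ⊥-elim (¬P0 P0)
least {suc n} P? (suc i , Pi) | no ¬P0 with least (P? ∘ suc) (i , Pi)
... | j , Pj , j-least = suc j , Pj , λ where
  zero    P0 → ⊥-elim (¬P0 P0)
  (suc l) Pl → s≤s (j-least l Pl)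

NonDecreasing : (ℕ → ℕ) → Set
NonDecreasing f = ∀ t → f t ≤ f (suc t)

UnitSteps : (ℕ → ℕ) → Set
UnitSteps f = ∀ t → f (suc t) ≡ f t ⊎ f (suc t) ≡ suc (f t)

module _ {f : ℕ → ℕ} where

  nonDecreasing⇒mono : NonDecreasing f → ∀ {t t′} → t ≤ t′ → f t ≤ f t′
  nonDecreasing⇒mono f↑ t≤t′ = go (≤⇒≤′ t≤t′)
    where
    go : ∀ {t t′} → t ≤′ t′ → f t ≤ f t′
    go ≤′-refl        = ≤-refl
    go (≤′-step t≤t′) = ≤-trans (go t≤t′) (f↑ _)

  nonDecreasing⇒passed : NonDecreasing f → ∀ {x t t′} → f t ≡ suc x → t ≤ t′ → x < f t′
  nonDecreasing⇒passed f↑ ft≡1+x t≤t′ = ≤-trans (≤-reflexive (sym ft≡1+x)) (nonDecreasing⇒mono f↑ t≤t′)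

  unitSteps⇒nonDecreasing : UnitSteps f → NonDecreasing f
  unitSteps⇒nonDecreasing steps t with steps t
  ... | inj₁ same = ≤-reflexive (sym same)
  ... | inj₂ up   = subst (f t ≤_) (sym up) (n≤1+n (f t))

  unitSteps⇒crossing : UnitSteps f → f 0 ≡ 0 → ∀ {i} T → i < f T →
                       Σ ℕ λ t → t < T × f t ≡ i × f (suc t) ≡ suc i
  unitSteps⇒crossing steps f0≡0 {i} zero i<f0 = ⊥-elim (n≮0 (subst (i <_) f0≡0 i<f0))
  unitSteps⇒crossing steps f0≡0 {i} (suc T) i<f[1+T] with i <? f T | steps T
  ... | yes i<fT | _ with unitSteps⇒crossing steps f0≡0 T i<fT
  ...   | t , t<T , ft≡i , f[1+t]≡1+i = t , m<n⇒m<1+n t<T , ft≡i , f[1+t]≡1+i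
  unitSteps⇒crossing steps f0≡0 {i} (suc T) i<f[1+T] | no i≮fT | inj₁ same =
    ⊥-elim (i≮fT (subst (i <_) same i<f[1+T]))
  unitSteps⇒crossing steps f0≡0 {i} (suc T) i<f[1+T] | no i≮fT | inj₂ up =
    T , n<1+n T , fT≡i , trans up (cong suc fT≡i)
    where
    fT≡i : f T ≡ i
    fT≡i = ≤-antisym (≮⇒≥ i≮fT) (≤-pred (subst (i <_) up i<f[1+T]))

-- Membership of x in the bag of step t of a sweep (f, g), for N q meaning
-- that x has a neighbour from q on the other side; see Ordered.InBag.
Present : (f g : ℕ → ℕ) (N : ℕ → Set) (x t : ℕ) → Set
Present f g N x t = x < f (suc t) × (x ≡ f t ⊎ N (g t))

present-convex : ∀ {f g : ℕ → ℕ} {N : ℕ → Set} {x} →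
                 NonDecreasing f → NonDecreasing g → (∀ {a b} → a ≤ b → N b → N a) →
                 ∀ {t₁ t₂ t₃} → t₁ ≤ t₂ → t₂ ≤ t₃ →
                 Present f g N x t₁ → Present f g N x t₃ → Present f g N x t₂
present-convex {f} {g} {N} {x} f↑ g↑ N↓ {t₁} {t₂} {t₃} t₁≤t₂ t₂≤t₃ present₁ (_ , now₃)
  with m≤n⇒m<n∨m≡n t₁≤t₂
... | inj₂ refl   = present₁
... | inj₁ t₁<t₂ = ≤-trans x<f[1+t₁] (nonDecreasing⇒mono f↑ (s≤s t₁≤t₂)) , [ ⊥-elim ∘ left , stays ]′ now₃
  where
  x<f[1+t₁] : x < f (suc t₁)
  x<f[1+t₁] = proj₁ present₁
  left : x ≢ f t₃
  left x≡ft₃ = <-irrefl x≡ft₃ (≤-trans x<f[1+t₁] (nonDecreasing⇒mono f↑ (≤-trans t₁<t₂ t₂≤t₃)))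
  stays : N (g t₃) → x ≡ f t₂ ⊎ N (g t₂)
  stays = inj₂ ∘ N↓ (nonDecreasing⇒mono g↑ t₂≤t₃)

-- Matrices in which a full anti-diagonal forces the diagonal

transpose : ∀ {m n} → BipMatrix m n → BipMatrix n m
transpose B j i = B i j

-- Monotone says exactly this of the reordered matrix: the three forbidden
-- patterns are the 2×2 submatrices with full anti-diagonal and non-full diagonal.
AntidiagClosed : ∀ {m n} → BipMatrix m n → Set
AntidiagClosed B = ∀ {i i′ j j′} → toℕ i < toℕ i′ → toℕ j < toℕ j′ →
                   B i j′ ≡ true → B i′ j ≡ true → B i j ≡ true × B i′ j′ ≡ true

transpose-closed : ∀ {m n} {B : BipMatrix m n} → AntidiagClosed B → AntidiagClosed (transpose B)
transpose-closed closed j<j′ i<i′ Bi′j Bij′ = closed i<i′ j<j′ Bij′ Bi′j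

record Biclique {m n} (B : BipMatrix m n) (d : ℕ) : Set where
  field
    rows           : Fin d → Fin m
    cols           : Fin d → Fin n
    rows-injective : Injective _≡_ _≡_ rows
    cols-injective : Injective _≡_ _≡_ cols
    complete       : ∀ a b → B (rows a) (cols b) ≡ true

biclique-transpose : ∀ {m n} {B : BipMatrix m n} {d} → Biclique (transpose B) d → Biclique B d
biclique-transpose K = record
  { rows = cols ; cols = rows ; rows-injective = cols-injective ; cols-injective = rows-injective
  ; complete = λ a b → complete b a }
  where open Biclique K

biclique-extend : ∀ {m n} {B : BipMatrix m n} {d} (K : Biclique B d) → let open Biclique K in
                  ∀ {i j} → (∀ a → rows a ≢ i) → (∀ b → cols b ≢ j) →
                  (∀ b → B i (cols b) ≡ true) → (∀ a → B (rows a) j ≡ true) → B i j ≡ true →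
                  Biclique B (suc d)
biclique-extend K {i} {j} i-fresh j-fresh i~cols rows~j i~j = record
  { rows           = i Vector.∷ rows
  ; cols           = j Vector.∷ cols
  ; rows-injective = fresh∷-injective rows-injective i-fresh
  ; cols-injective = fresh∷-injective cols-injective j-fresh
  ; complete       = λ where
      zero    zero    → i~j
      zero    (suc b) → i~cols b
      (suc a) zero    → rows~j a
      (suc a) (suc b) → complete a b }
  where open Biclique K

module Ordered {m n} (B : BipMatrix m n) (closed : AntidiagClosed B) where

  infix 4 _~_
  _~_ : Fin m → Fin n → Set
  i ~ j = B i j ≡ true

  NeighbourFrom : ℕ → Pred (Fin m) 0ℓ
  NeighbourFrom q i = Σ (Fin n) λ j → q ≤ toℕ j × i ~ j

  ColNeighbourFrom : ℕ → Pred (Fin n) 0ℓ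
  ColNeighbourFrom p j = Σ (Fin m) λ i → p ≤ toℕ i × i ~ j

  neighbourFrom? : ∀ q → Decidable (NeighbourFrom q)
  neighbourFrom? q i = Finₚ.any? λ j → (q ≤? toℕ j) ×-dec (B i j Bool.≟ true)

  Active : ℕ → ℕ → Pred (Fin m) 0ℓ
  Active p q i = toℕ i < p × NeighbourFrom q i

  active? : ∀ p q → Decidable (Active p q)
  active? p q i = (toℕ i <? p) ×-dec neighbourFrom? q i

  ActiveCol : ℕ → ℕ → Pred (Fin n) 0ℓ
  ActiveCol p q j = toℕ j < q × ColNeighbourFrom p j

  -- Rows in the bag of a step moving the row pointer from p to p′, with q columns introduced.
  InBag : ℕ → ℕ → ℕ → Pred (Fin m) 0ℓ
  InBag p p′ q i = toℕ i < p′ × (toℕ i ≡ p ⊎ NeighbourFrom q i)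

  inBag? : ∀ p p′ q → Decidable (InBag p p′ q)
  inBag? p p′ q i = (toℕ i <? p′) ×-dec ((toℕ i ≟ p) ⊎-dec neighbourFrom? q i)

  FirstRowFrom : ℕ → Pred (Fin m) 0ℓ
  FirstRowFrom p = Least λ i → p ≤ toℕ i × NeighbourFrom 0 i

  FirstColFrom : ℕ → Pred (Fin n) 0ℓ
  FirstColFrom q = Least λ j → q ≤ toℕ j × ColNeighbourFrom 0 j

  activeCol⇒firstRowFrom : ∀ {p q y} → ActiveCol p q y → ∃ (FirstRowFrom p)
  activeCol⇒firstRowFrom {p} {y = y} (_ , r , p≤r , r~y) =
    least (λ i → (p ≤? toℕ i) ×-dec neighbourFrom? 0 i) (r , p≤r , y , z≤n , r~y)

  ~-between : ∀ {x a b c} → toℕ a < toℕ b → toℕ b ≤ toℕ c → x ~ a → x ~ c →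
              ColNeighbourFrom 0 b → x ~ b
  ~-between {x} {a} {b} {c} a<b b≤c x~a x~c (i , _ , i~b)
    with m≤n⇒m<n∨m≡n b≤c | <-cmp (toℕ i) (toℕ x)
  ... | inj₂ b≡c | _            = subst (x ~_) (sym (toℕ-injective b≡c)) x~c
  ... | inj₁ _   | tri≈ _ i≡x _ = subst (_~ b) (toℕ-injective i≡x) i~b
  ... | inj₁ _   | tri< i<x _ _ = proj₂ (closed i<x a<b i~b x~a)
  ... | inj₁ b<c | tri> _ _ x<i = proj₁ (closed x<i b<c x~c i~b)

  active-complete : ∀ {p q x y} → Active p q x → ActiveCol p q y → x ~ y
  active-complete (x<p , c , q≤c , x~c) (y<q , r , p≤r , r~y) =
    proj₁ (closed (<-≤-trans x<p p≤r) (<-≤-trans y<q q≤c) x~c r~y)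

  ~-firstCol : ∀ {q x y qs} → toℕ y < q → x ~ y → NeighbourFrom q x → FirstColFrom q qs → x ~ qs
  ~-firstCol {x = x} y<q x~y (c , q≤c , x~c) ((q≤qs , qs-used) , qs-least) =
    ~-between (<-≤-trans y<q q≤qs) (qs-least c (q≤c , x , z≤n , x~c)) x~y x~c qs-used

  firstRow~activeCol : ∀ {p q ps y} → FirstRowFrom p ps → NeighbourFrom q ps → ActiveCol p q y → ps ~ y
  firstRow~activeCol {y = y} (_ , ps-least) (j , q≤j , ps~j) (y<q , r , p≤r , r~y)
    with m≤n⇒m<n∨m≡n (ps-least r (p≤r , y , z≤n , r~y))
  ... | inj₁ ps<r = proj₁ (closed ps<r (<-≤-trans y<q q≤j) ps~j r~y)
  ... | inj₂ ps≡r = subst (_~ y) (sym (toℕ-injective ps≡r)) r~y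

  firstRow-or-firstCol-reaches : ∀ {p q ps qs} → FirstRowFrom p ps → FirstColFrom q qs →
                                 NeighbourFrom q ps ⊎ ColNeighbourFrom p qs
  firstRow-or-firstCol-reaches {p} {q} {ps} {qs} ((p≤ps , y , _ , ps~y) , _) ((q≤qs , x , _ , x~qs) , _)
    with q ≤? toℕ y | p ≤? toℕ x
  ... | yes q≤y | _       = inj₁ (y , q≤y , ps~y)
  ... | no _    | yes p≤x = inj₂ (x , p≤x , x~qs)
  ... | no q≰y  | no p≰x  =
    inj₁ (qs , q≤qs , proj₂ (closed (<-≤-trans (≰⇒> p≰x) p≤ps) (<-≤-trans (≰⇒> q≰y) q≤qs) x~qs ps~y))

  extend-active : ∀ {p q d ps qs} →
                  Enumeration (Active p q) (suc d) → Enumeration (ActiveCol p q) (suc d) →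
                  FirstRowFrom p ps → FirstColFrom q qs → NeighbourFrom q ps →
                  Biclique B (suc (suc d))
  extend-active {ps = ps} {qs} (ex , ex-inj , ex-active) (ey , ey-inj , ey-active)
                ps-first@((p≤ps , _) , _) qs-first@((q≤qs , _) , _) ps-reaches =
    biclique-extend K
      (λ a → <⇒≢ (<-≤-trans (proj₁ (ex-active a)) p≤ps) ∘ cong toℕ)
      (λ b → <⇒≢ (<-≤-trans (proj₁ (ey-active b)) q≤qs) ∘ cong toℕ)
      ps~ey ex~qs (~-firstCol y₀<q (ps~ey zero) ps-reaches qs-first)
    where
    K : Biclique B _
    K = record { rows = ex ; cols = ey ; rows-injective = ex-inj ; cols-injective = ey-inj
               ; complete = λ a b → active-complete (ex-active a) (ey-active b) }
    y₀<q = proj₁ (ey-active zero)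
    ps~ey : ∀ b → ps ~ ey b
    ps~ey b = firstRow~activeCol ps-first ps-reaches (ey-active b)
    ex~qs : ∀ a → ex a ~ qs
    ex~qs a = ~-firstCol y₀<q (Biclique.complete K a zero) (proj₂ (ex-active a)) qs-first

  ∣inBag∣-stay : ∀ p q → ∣ ⟦ inBag? p p q ⟧ ∣ ≤ ∣ ⟦ active? p q ⟧ ∣
  ∣inBag∣-stay p q = ∣⟦⟧∣-mono (inBag? p p q) (active? p q) λ where
    (i<p , inj₁ i≡p) → ⊥-elim (<-irrefl i≡p i<p)
    (i<p , inj₂ nb)  → i<p , nb

  ∣inBag∣-advance : ∀ p q → ∣ ⟦ inBag? p (suc p) q ⟧ ∣ ≤ suc ∣ ⟦ active? p q ⟧ ∣
  ∣inBag∣-advance p q = ∣⟦⟧∣≤1+ (inBag? p (suc p) q) (active? p q) p λ where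
    (_      , inj₁ i≡p) → inj₁ i≡p
    (i<1+p , inj₂ nb)  → Sum.map₂ (_, nb) (Sum.swap (m≤n⇒m<n∨m≡n (≤-pred i<1+p)))

  ∣active∣-advance : ∀ p q → ∣ ⟦ active? (suc p) q ⟧ ∣ ≤ suc ∣ ⟦ active? p q ⟧ ∣
  ∣active∣-advance p q = ≤-trans
    (∣⟦⟧∣-mono (active? (suc p) q) (inBag? p (suc p) q) (Product.map₂ inj₂))
    (∣inBag∣-advance p q)

  ∣active∣-shrink : ∀ p q → ∣ ⟦ active? p (suc q) ⟧ ∣ ≤ ∣ ⟦ active? p q ⟧ ∣
  ∣active∣-shrink p q = ∣⟦⟧∣-mono (active? p (suc q)) (active? p q)
    λ (i<p , j , q<j , i~j) → i<p , j , <⇒≤ q<j , i~j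

  ∣active∣-start : ∀ q → ∣ ⟦ active? 0 q ⟧ ∣ ≡ 0
  ∣active∣-start q = ∣⟦⟧∣≡0 (active? 0 q) λ ()

  ∣active∣-exhausted : ∀ p {q} → n ≤ q → ∣ ⟦ active? p q ⟧ ∣ ≡ 0
  ∣active∣-exhausted p n≤q = ∣⟦⟧∣≡0 (active? p _)
    λ (_ , j , q≤j , _) → <⇒≱ (Finₚ.toℕ<n j) (≤-trans n≤q q≤j)

module _ {m n} {B : BipMatrix m n} (closed : AntidiagClosed B) where
  private
    module R = Ordered B closed
    module C = Ordered (transpose B) (transpose-closed closed)

  large-active⇒biclique : ∀ {p q d} →
    suc d ≤ ∣ ⟦ R.active? p q ⟧ ∣ → suc d ≤ ∣ ⟦ C.active? q p ⟧ ∣ → Biclique B (suc (suc d))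
  large-active⇒biclique {p} {q} many-rows many-cols
    with enumerate⟦⟧ (R.active? p q) many-rows | enumerate⟦⟧ (C.active? q p) many-cols
  ... | X@(_ , _ , ex-active) | Y@(_ , _ , ey-active)
    with R.activeCol⇒firstRowFrom (ey-active zero) | C.activeCol⇒firstRowFrom (ex-active zero)
  ... | ps , ps-first | qs , qs-first with R.firstRow-or-firstCol-reaches ps-first qs-first
  ... | inj₁ ps-reaches = R.extend-active X Y ps-first qs-first ps-reaches
  ... | inj₂ qs-reaches = biclique-transpose (C.extend-active Y X qs-first ps-first qs-reaches)

-- The staircase sweep

within : ∀ {T t} {Pr : ℕ → Set} → t < T → Pr t → Σ (Fin T) (Pr ∘ toℕ)
within {Pr = Pr} t<T Pr-t = fromℕ< t<T , subst Pr (sym (Finₚ.toℕ-fromℕ< t<T)) Pr-t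

module Walk {m n} (B : BipMatrix m n) (closed : AntidiagClosed B)
            (k : ℕ) (no-biclique : ¬ Biclique B (suc (suc k))) where
  private
    module R = Ordered B closed
    module C = Ordered (transpose B) (transpose-closed closed)

  ∣X∣ ∣Y∣ : ℕ → ℕ → ℕ
  ∣X∣ p q = ∣ ⟦ R.active? p q ⟧ ∣
  ∣Y∣ p q = ∣ ⟦ C.active? q p ⟧ ∣

  AdvanceRow : ℕ → ℕ → Set
  AdvanceRow p q = p < m × (∣X∣ p q ≤ k ⊎ n ≤ q)

  advanceRow? : ∀ p q → Dec (AdvanceRow p q)
  advanceRow? p q = (p <? m) ×-dec ((∣X∣ p q ≤? k) ⊎-dec (n ≤? q))

  data Step (p q : ℕ) : ℕ × ℕ → Set where
    row : AdvanceRow p q → Step p q (suc p , q)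
    col : ¬ AdvanceRow p q → Step p q (p , suc q)

  -- Opaque, so that walk positions never unfold into the counting decisions.
  opaque
    next : ℕ × ℕ → ℕ × ℕ
    next (p , q) with advanceRow? p q
    ... | yes _ = suc p , q
    ... | no  _ = p , suc q

    step : ∀ p q → Step p q (next (p , q))
    step p q with advanceRow? p q
    ... | yes advance  = row advance
    ... | no ¬advance = col ¬advance

  walk : ℕ → ℕ × ℕ
  walk zero    = 0 , 0
  walk (suc t) = next (walk t)

  P Q : ℕ → ℕ
  P = proj₁ ∘ walk
  Q = proj₂ ∘ walk

  walk-step : ∀ t → Step (P t) (Q t) (P (suc t) , Q (suc t))
  walk-step t = step (P t) (Q t)

  module _ {p q : ℕ} where

    row-room : AdvanceRow p q → ∣X∣ p q ≤ k
    row-room (_ , inj₁ x≤k) = x≤k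
    row-room (_ , inj₂ n≤q) = ≤-trans (≤-reflexive (R.∣active∣-exhausted p n≤q)) z≤n

    col-room : ¬ AdvanceRow p q → ∣Y∣ p q ≤ k
    col-room ¬advance with p <? m | ∣Y∣ p q ≤? k
    ... | no p≮m | _       = ≤-trans (≤-reflexive (C.∣active∣-exhausted q (≮⇒≥ p≮m))) z≤n
    ... | yes _  | yes y≤k = y≤k
    ... | yes p<m | no y≰k =
      ⊥-elim (no-biclique (large-active⇒biclique closed (≰⇒> (¬advance ∘ (p<m ,_) ∘ inj₁)) (≰⇒> y≰k)))

  Bounded : ℕ → ℕ → Set
  Bounded p q = ∣X∣ p q ≤ suc k × ∣Y∣ p q ≤ suc k

  module _ {p q p′ q′ : ℕ} where

    Step-bounded : Step p q (p′ , q′) → Bounded p q → Bounded p′ q′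
    Step-bounded (row advance) (_ , y≤) =
      ≤-trans (R.∣active∣-advance p q) (s≤s (row-room advance)) , ≤-trans (C.∣active∣-shrink q p) y≤
    Step-bounded (col ¬advance) (x≤ , _) =
      ≤-trans (R.∣active∣-shrink p q) x≤ , ≤-trans (C.∣active∣-advance q p) (s≤s (col-room ¬advance))

    Step-bag-bounded : Step p q (p′ , q′) → Bounded p q →
                       ∣ ⟦ R.inBag? p p′ q ⟧ ∣ ≤ suc k × ∣ ⟦ C.inBag? q q′ p ⟧ ∣ ≤ suc k
    Step-bag-bounded (row advance) (_ , y≤) =
      ≤-trans (R.∣inBag∣-advance p q) (s≤s (row-room advance)) , ≤-trans (C.∣inBag∣-stay q p) y≤
    Step-bag-bounded (col ¬advance) (x≤ , _) =
      ≤-trans (R.∣inBag∣-stay p q) x≤ , ≤-trans (C.∣inBag∣-advance q p) (s≤s (col-room ¬advance))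

    Step-row : Step p q (p′ , q′) → p′ ≡ p ⊎ p′ ≡ suc p
    Step-row (row _) = inj₂ refl
    Step-row (col _) = inj₁ refl

    Step-col : Step p q (p′ , q′) → q′ ≡ q ⊎ q′ ≡ suc q
    Step-col (row _) = inj₁ refl
    Step-col (col _) = inj₂ refl

    Step-sum : Step p q (p′ , q′) → p′ + q′ ≡ suc (p + q)
    Step-sum (row _) = refl
    Step-sum (col _) = +-suc p q

    Step-single : Step p q (p′ , q′) → p′ ≡ suc p → q′ ≡ suc q → ⊥
    Step-single (row _) _    q≡1+q = 1+n≢n (sym q≡1+q)
    Step-single (col _) p≡1+p _    = 1+n≢n (sym p≡1+p)

    Step-inGrid : p ≤ m → q ≤ n → p + q < m + n → Step p q (p′ , q′) → p′ ≤ m × q′ ≤ n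
    Step-inGrid _   q≤n _       (row (p<m , _)) = p<m , q≤n
    Step-inGrid p≤m _   p+q<m+n (col ¬advance)  = p≤m , ≰⇒> λ n≤q →
      ¬advance (+-cancelʳ-< n p m (≤-<-trans (+-monoʳ-≤ p n≤q) p+q<m+n) , inj₂ n≤q)

  bounded : ∀ t → Bounded (P t) (Q t)
  bounded zero    = ≤-trans (≤-reflexive (R.∣active∣-start 0)) z≤n
                  , ≤-trans (≤-reflexive (C.∣active∣-start 0)) z≤n
  bounded (suc t) = Step-bounded (walk-step t) (bounded t)

  P-unitSteps : UnitSteps P
  P-unitSteps t = Step-row (walk-step t)

  Q-unitSteps : UnitSteps Q
  Q-unitSteps t = Step-col (walk-step t)

  P+Q≡t : ∀ t → P t + Q t ≡ t
  P+Q≡t zero    = refl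
  P+Q≡t (suc t) = trans (Step-sum (walk-step t)) (cong suc (P+Q≡t t))

  inGrid : ∀ t → t ≤ m + n → P t ≤ m × Q t ≤ n
  inGrid zero    _       = z≤n , z≤n
  inGrid (suc t) t<m+n with inGrid t (<⇒≤ t<m+n)
  ... | p≤m , q≤n = Step-inGrid p≤m q≤n (subst (_< m + n) (sym (P+Q≡t t)) t<m+n) (walk-step t)

  walk-end : m ≤ P (m + n) × n ≤ Q (m + n)
  walk-end = +-cancelʳ-≤ n m (P (m + n)) (≤-trans (≤-reflexive m+n≡) (+-monoʳ-≤ (P (m + n)) q≤n))
           , +-cancelˡ-≤ m n (Q (m + n)) (≤-trans (≤-reflexive m+n≡) (+-monoˡ-≤ (Q (m + n)) p≤m))
    where
    p≤m = proj₁ (inGrid (m + n) ≤-refl)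
    q≤n = proj₂ (inGrid (m + n) ≤-refl)
    m+n≡ : m + n ≡ P (m + n) + Q (m + n)
    m+n≡ = sym (P+Q≡t (m + n))

  RowIn : ℕ → Pred (Fin m) 0ℓ
  RowIn t = R.InBag (P t) (P (suc t)) (Q t)

  rowIn? : ∀ t → Decidable (RowIn t)
  rowIn? t = R.inBag? (P t) (P (suc t)) (Q t)

  ColIn : ℕ → Pred (Fin n) 0ℓ
  ColIn t = C.InBag (Q t) (Q (suc t)) (P t)

  colIn? : ∀ t → Decidable (ColIn t)
  colIn? t = C.inBag? (Q t) (Q (suc t)) (P t)

  bag-bounded : ∀ t → ∣ ⟦ rowIn? t ⟧ ∣ ≤ suc k × ∣ ⟦ colIn? t ⟧ ∣ ≤ suc k
  bag-bounded t = Step-bag-bounded (walk-step t) (bounded t)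

  private
    P↑ = unitSteps⇒nonDecreasing P-unitSteps
    Q↑ = unitSteps⇒nonDecreasing Q-unitSteps

  row-entry : ∀ (i : Fin m) → Σ ℕ λ t → t < m + n × P t ≡ toℕ i × P (suc t) ≡ suc (toℕ i)
  row-entry i = unitSteps⇒crossing P-unitSteps refl (m + n) (<-≤-trans (Finₚ.toℕ<n i) (proj₁ walk-end))

  col-entry : ∀ (j : Fin n) → Σ ℕ λ t → t < m + n × Q t ≡ toℕ j × Q (suc t) ≡ suc (toℕ j)
  col-entry j = unitSteps⇒crossing Q-unitSteps refl (m + n) (<-≤-trans (Finₚ.toℕ<n j) (proj₂ walk-end))

  rowIn-cover : ∀ i → Σ (Fin (m + n)) λ t → RowIn (toℕ t) i
  rowIn-cover i with row-entry i
  ... | t , t< , Pt≡i , P[1+t]≡1+i = within {Pr = λ t → RowIn t i} t< (nonDecreasing⇒passed P↑ {t = suc t} P[1+t]≡1+i ≤-refl , inj₁ (sym Pt≡i))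

  colIn-cover : ∀ j → Σ (Fin (m + n)) λ t → ColIn (toℕ t) j
  colIn-cover j with col-entry j
  ... | t , t< , Qt≡j , Q[1+t]≡1+j = within {Pr = λ t → ColIn t j} t< (nonDecreasing⇒passed Q↑ {t = suc t} Q[1+t]≡1+j ≤-refl , inj₁ (sym Qt≡j))

  edge-cover : ∀ {i j} → B i j ≡ true → Σ (Fin (m + n)) λ t → RowIn (toℕ t) i × ColIn (toℕ t) j
  edge-cover {i} {j} i~j with row-entry i | col-entry j
  ... | t₁ , t₁< , Pt₁≡i , P[1+t₁]≡1+i | t₂ , t₂< , Qt₂≡j , Q[1+t₂]≡1+j with <-cmp t₁ t₂
  ... | tri< t₁<t₂ _ _ = within {Pr = λ t → RowIn t i × ColIn t j} t₂<
    ( (nonDecreasing⇒passed P↑ {t = suc t₁} P[1+t₁]≡1+i t₁<t₂′ , inj₂ (j , ≤-reflexive Qt₂≡j , i~j))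
    , (nonDecreasing⇒passed Q↑ {t = suc t₂} Q[1+t₂]≡1+j ≤-refl , inj₁ (sym Qt₂≡j)) )
    where t₁<t₂′ = s≤s (<⇒≤ t₁<t₂)
  ... | tri> _ _ t₂<t₁ = within {Pr = λ t → RowIn t i × ColIn t j} t₁<
    ( (nonDecreasing⇒passed P↑ {t = suc t₁} P[1+t₁]≡1+i ≤-refl , inj₁ (sym Pt₁≡i))
    , (nonDecreasing⇒passed Q↑ {t = suc t₂} Q[1+t₂]≡1+j (s≤s (<⇒≤ t₂<t₁)) , inj₂ (i , ≤-reflexive Pt₁≡i , i~j)) )
  ... | tri≈ _ refl _ = ⊥-elim (Step-single (walk-step t₁)
    (trans P[1+t₁]≡1+i (cong suc (sym Pt₁≡i))) (trans Q[1+t₂]≡1+j (cong suc (sym Qt₂≡j))))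

  rowIn-convex : ∀ i {t₁ t₂ t₃} → t₁ ≤ t₂ → t₂ ≤ t₃ → RowIn t₁ i → RowIn t₃ i → RowIn t₂ i
  rowIn-convex i = present-convex {N = λ q → R.NeighbourFrom q i} P↑ Q↑ λ a≤b (j , b≤j , i~j) → j , ≤-trans a≤b b≤j , i~j

  colIn-convex : ∀ j {t₁ t₂ t₃} → t₁ ≤ t₂ → t₂ ≤ t₃ → ColIn t₁ j → ColIn t₃ j → ColIn t₂ j
  colIn-convex j = present-convex {N = λ p → C.NeighbourFrom p j} Q↑ P↑ λ a≤b (i , b≤i , i~j) → i , ≤-trans a≤b b≤i , i~j

-- Back to the monotone graph

¬Forbidden⇒diagonal : ∀ {a b c d} → ¬ Forbidden a b c d → b ≡ true → c ≡ true → a ≡ true × d ≡ true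
¬Forbidden⇒diagonal {true}  {d = true}  _      refl refl = refl , refl
¬Forbidden⇒diagonal {true}  {d = false} allows refl refl = ⊥-elim (allows tt)
¬Forbidden⇒diagonal {false} {d = true}  allows refl refl = ⊥-elim (allows tt)
¬Forbidden⇒diagonal {false} {d = false} allows refl refl = ⊥-elim (allows tt)

constant-injective : ∀ {A : Set} (x : A) → Injective _≡_ _≡_ (λ (_ : Fin 1) → x)
constant-injective x {zero} {zero} _ = refl

edge⇒K₁₁ : ∀ {m n} {A : BipMatrix m n} → HasEdge A → ContainsKdd A 1
edge⇒K₁₁ {A = A} (u , v , u~v) =
  (λ _ → u) , (λ _ → v) , constant-injective u , constant-injective v ,
  (λ _ _ u≡v → irreflexive u (subst (Adj A u) (sym u≡v) u~v)) , λ _ _ → u~v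
  where
  irreflexive : ∀ w → ¬ Adj A w w
  irreflexive (inj₁ _) ()
  irreflexive (inj₂ _) ()

module Reordered {m n} (A : BipMatrix m n) (σ : Permutation′ m) (τ : Permutation′ n) where

  B : BipMatrix m n
  B i j = A (σ ⟨$⟩ʳ i) (τ ⟨$⟩ʳ j)

  avoiding⇒closed : (∀ i i′ j j′ → i <ᶠ i′ → j <ᶠ j′ → ¬ Forbidden (B i j) (B i j′) (B i′ j) (B i′ j′)) →
                    AntidiagClosed B
  avoiding⇒closed avoids {i} {i′} {j} {j′} i<i′ j<j′ = ¬Forbidden⇒diagonal (avoids i i′ j j′ i<i′ j<j′)

  biclique⇒Kdd : ∀ {d} → Biclique B d → ContainsKdd A d
  biclique⇒Kdd K =
    inj₁ ∘ (σ ⟨$⟩ʳ_) ∘ rows , inj₂ ∘ (τ ⟨$⟩ʳ_) ∘ cols ,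
    rows-injective ∘ permutation-injective σ ∘ inj₁-injective ,
    cols-injective ∘ permutation-injective τ ∘ inj₂-injective ,
    (λ _ _ ()) , complete
    where
    open Biclique K
    permutation-injective : ∀ {l} (π : Permutation′ l) → Injective _≡_ _≡_ (π ⟨$⟩ʳ_)
    permutation-injective π = Injection.injective (↔⇒↣ π)

  pathDecomposition : AntidiagClosed B → ∀ k → ¬ Biclique B (suc (suc k)) →
                      HasPathDecompWithBagsAtMost A (2 * suc k)
  pathDecomposition closed k no-biclique = decomposition , bag-size
    where
    open Walk B closed k no-biclique

    bag : Fin (m + n) → Bag m n
    bag t = ⟦ rowIn? (toℕ t) ∘ (σ ⟨$⟩ˡ_) ⟧ , ⟦ colIn? (toℕ t) ∘ (τ ⟨$⟩ˡ_) ⟧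

    row∈ : ∀ t u → RowIn (toℕ t) (σ ⟨$⟩ˡ u) → inj₁ u ∈B bag t
    row∈ t u = ∈⟦⟧⁺ (rowIn? (toℕ t) ∘ (σ ⟨$⟩ˡ_))

    col∈ : ∀ t w → ColIn (toℕ t) (τ ⟨$⟩ˡ w) → inj₂ w ∈B bag t
    col∈ t w = ∈⟦⟧⁺ (colIn? (toℕ t) ∘ (τ ⟨$⟩ˡ_))

    ∈row : ∀ t u → inj₁ u ∈B bag t → RowIn (toℕ t) (σ ⟨$⟩ˡ u)
    ∈row t u = ∈⟦⟧⁻ (rowIn? (toℕ t) ∘ (σ ⟨$⟩ˡ_))

    ∈col : ∀ t w → inj₂ w ∈B bag t → ColIn (toℕ t) (τ ⟨$⟩ˡ w)
    ∈col t w = ∈⟦⟧⁻ (colIn? (toℕ t) ∘ (τ ⟨$⟩ˡ_))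

    edge-in-bag : ∀ {u w} → A u w ≡ true → Σ (Fin (m + n)) λ t → inj₁ u ∈B bag t × inj₂ w ∈B bag t
    edge-in-bag {u} {w} u~w =
      Product.map₂ (λ {t} → Product.map (row∈ t u) (col∈ t w))
        (edge-cover (subst₂ (λ x y → A x y ≡ true) (sym (inverseʳ σ)) (sym (inverseʳ τ)) u~w))

    decomposition : PathDecomposition A
    decomposition = record
      { r        = m + n
      ; bag      = bag
      ; cover    = λ where
          (inj₁ u) → Product.map₂ (λ {t} → row∈ t u) (rowIn-cover (σ ⟨$⟩ˡ u))
          (inj₂ w) → Product.map₂ (λ {t} → col∈ t w) (colIn-cover (τ ⟨$⟩ˡ w))
      ; edges    = λ where
          (inj₁ u) (inj₂ w) u~w → edge-in-bag u~w
          (inj₂ w) (inj₁ u) u~w → Product.map₂ Product.swap (edge-in-bag u~w)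
      ; interval = λ where
          (inj₁ u) t₁ t₂ t₃ t₁≤t₂ t₂≤t₃ u∈₁ u∈₃ →
            row∈ t₂ u (rowIn-convex _ t₁≤t₂ t₂≤t₃ (∈row t₁ u u∈₁) (∈row t₃ u u∈₃))
          (inj₂ w) t₁ t₂ t₃ t₁≤t₂ t₂≤t₃ w∈₁ w∈₃ →
            col∈ t₂ w (colIn-convex _ t₁≤t₂ t₂≤t₃ (∈col t₁ w w∈₁) (∈col t₃ w w∈₃))
      }

    bag-size : ∀ t → size (bag t) ≤ 2 * suc k
    bag-size t = +-mono-≤ (≤-trans (≤-reflexive rows-permuted) (proj₁ (bag-bounded (toℕ t))))
                          (≤-trans (≤-reflexive cols-permuted) (≤-trans (proj₂ (bag-bounded (toℕ t))) (m≤m+n _ 0)))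
      where
      rows-permuted = ∣tabulate∣-permute (does ∘ rowIn? (toℕ t)) σ
      cols-permuted = ∣tabulate∣-permute (does ∘ colIn? (toℕ t)) τ

theorem20 : ∀ {m n} (A : BipMatrix m n) → Monotone A → HasEdge A →
    (k : ℕ) → IsPsi A k → HasPathDecompWithBagsAtMost A (2 * k)
theorem20 A _ edge zero (_ , maximal) = ⊥-elim (1+n≰n (maximal 1 (edge⇒K₁₁ edge)))
theorem20 A (σ , τ , avoids) _ (suc k) (_ , maximal) =
  pathDecomposition (avoiding⇒closed avoids) k λ K → 1+n≰n (maximal _ (biclique⇒Kdd K))
  where open Reordered A σ τ
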